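{- For all $n\ge 3$, $\overline{q}_n(123,132,231,312)=3$.
   Context: For a positive integer $n$, let $\mathcal{S}_{n,n}$ denote the set of all permutations (words) $\pi=\pi_1\cdots\pi_{2n}$ of the multiset $\{1,1,2,2,\ldots,n,n\}$. A word $\pi$ contains a pattern $\sigma=\sigma_1\cdots\sigma_k$ if there are indices $i_1<\cdots<i_k$ such that $\pi_{i_a}=\pi_{i_b}$ iff $\sigma_a=\sigma_b$ and $\pi_{i_a}<\pi_{i_b}$ iff $\sigma_a<\sigma_b$ for all $a,b$; otherwise $\pi$ avoids $\sigma$. The quasi-Stirling permutations $\overline{\mathcal{Q}}_n$ are the $\pi\in\mathcal{S}_{n,n}$ avoiding both $1212$ and $2121$. For a set $\Lambda$ of patterns, $\overline{\mathcal{Q}}_n(\Lambda)$ is the set of $\pi\in\overline{\mathcal{Q}}_n$ avoiding every pattern in $\Lambda$, and $\overline{q}_n(\Lambda)=|\overline{\mathcal{Q}}_n(\Lambda)|$. -}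

module Defs where

open import Data.Nat using (ℕ; suc; _<_)
open import Data.List using (List; []; _∷_; length; lookup; map; concatMap; upTo)
open import Data.List.Relation.Binary.Sublist.Propositional using (_⊆_)
open import Data.List.Relation.Binary.Permutation.Propositional using (_↭_)
open import Data.List.Relation.Unary.Unique.Propositional using (Unique)
open import Data.List.Membership.Propositional using (_∈_)
open import Data.Fin using (Fin; cast)
open import Data.Product using (Σ; _×_; ∃)
open import Function.Bundles using (_⇔_)
open import Relation.Binary.PropositionalEquality using (_≡_)
open import Relation.Nullary using (¬_)

multiset : ℕ → List ℕ
multiset n = concatMap (λ k → k ∷ k ∷ []) (map suc (upTo n))

IsSnn : ℕ → List ℕ → Set
IsSnn n π = π ↭ multiset n

OrderIso : List ℕ → List ℕ → Set
OrderIso τ σ =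
  Σ (length τ ≡ length σ) λ eq →
    (a b : Fin (length τ)) →
      ((lookup τ a ≡ lookup τ b) ⇔ (lookup σ (cast eq a) ≡ lookup σ (cast eq b)))
      × ((lookup τ a < lookup τ b) ⇔ (lookup σ (cast eq a) < lookup σ (cast eq b)))

Contains : List ℕ → List ℕ → Set
Contains π σ = ∃ λ τ → (τ ⊆ π) × OrderIso τ σ

Avoids : List ℕ → List ℕ → Set
Avoids π σ = ¬ Contains π σ

AvoidsAll : List ℕ → List (List ℕ) → Set
AvoidsAll π [] = Data.Unit.⊤ where import Data.Unit
AvoidsAll π (σ ∷ Λ) = Avoids π σ × AvoidsAll π Λ

IsQuasiStirling : ℕ → List ℕ → Set
IsQuasiStirling n π =
  IsSnn n π × Avoids π (1 ∷ 2 ∷ 1 ∷ 2 ∷ []) × Avoids π (2 ∷ 1 ∷ 2 ∷ 1 ∷ [])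

InQbar : ℕ → List (List ℕ) → List ℕ → Set
InQbar n Λ π = IsQuasiStirling n π × AvoidsAll π Λ

HasCard : (List ℕ → Set) → ℕ → Set
HasCard P k = ∃ λ (L : List (List ℕ)) →
  Unique L × length L ≡ k × ((π : List ℕ) → (π ∈ L) ⇔ P π)

qbar≡ : ℕ → List (List ℕ) → ℕ → Set
qbar≡ n Λ k = HasCard (InQbar n Λ) k

-- For n = m + 1 ≥ 3 the three words are D n n, n D n and n n D, where D = m m … 1 1 is the
-- decreasing arrangement of the smaller letters. In each of them every ascent ends at the top
-- letter n, and once a smaller letter has climbed to n only n's follow; such words avoid all six
-- patterns. Conversely, write π = a n b n c. If π avoids 132 and 231, any two letters below n lying
-- on opposite sides of an occurrence of n are equal; as both 1 and 2 occur, no small letter lies on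
-- both sides of either n, so two of the blocks a, b, c are empty. The remaining block has no ascent
-- (it would form a 123 with the n's after it or a 312 with the n before it), hence it is D.
module Submission where

open import Defs
open import Data.Nat using (ℕ; zero; suc; _≤_; _<_; _≥_; s≤s; z<s; s<s; _≟_)
open import Data.Nat.Properties
  using (≤-refl; ≤-reflexive; ≤-totalOrder; n≤1+n; <⇒≤; <⇒≢; <⇒≱; <-asym; <-irrefl; ≮⇒≥; ≤∧≢⇒<; <-cmp; <-trans)
open import Data.List using (List; []; _∷_; _++_; [_]; upTo; map; concatMap)
open import Data.List.Properties
  using (++-assoc; ++-identityʳ; ++-conicalˡ; ++-conicalʳ; map-++; concatMap-++; upTo-∷ʳ)
open import Data.List.Membership.Propositional using (_∈_)
open import Data.List.Membership.Propositional.Properties using (∈-∃++; ∈-++⁻; ∈-++⁺ˡ; ∈-++⁺ʳ)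
open import Data.List.Relation.Unary.Any using (here; there)
open import Data.List.Relation.Unary.All as All using (All; []; _∷_)
open import Data.List.Relation.Unary.All.Properties as All using ()
open import Data.List.Relation.Unary.AllPairs using (AllPairs; []; _∷_)
open import Data.List.Relation.Unary.AllPairs.Properties as AllPairs using ()
open import Data.List.Relation.Unary.Linked using ([]; [-]; _∷_)
open import Data.List.Relation.Unary.Unique.Propositional using (Unique)
open import Data.List.Relation.Binary.Sublist.Propositional
  using (_⊆_; []; _∷_; _∷ʳ_; minimum; ⊆-refl; ⊆-reflexive; ⊆-trans; from∈; lookup)
open import Data.List.Relation.Binary.Sublist.Propositional.Properties using (++⁺; ++⁺ʳ; All-resp-⊆)
open import Data.List.Relation.Binary.Permutation.Propositional
  using (_↭_; ↭-refl; ↭-sym; ↭-trans; prep; ↭⇒↭ₛ′; module PermutationReasoning)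
open import Data.List.Relation.Binary.Permutation.Propositional.Properties
  using (++-comm; drop-mid; All-resp-↭; ∈-resp-↭)
open import Data.List.Relation.Binary.Pointwise using (Pointwise-≡⇒≡)
open import Data.List.Relation.Unary.Sorted.TotalOrder.Properties using (↗↭↗⇒≋; Sorted⇒AllPairs)
open import Relation.Binary.Properties.TotalOrder ≤-totalOrder using (≥-totalOrder)
open import Data.List.Relation.Unary.Sorted.TotalOrder ≥-totalOrder renaming (Sorted to Descending)
open import Data.Fin using (zero; suc; cast)
open import Data.Product using (∃; ∃₂; _×_; _,_; proj₁; proj₂)
open import Data.Sum as Sum using (_⊎_; inj₁; inj₂)
open import Data.Unit using (tt)
open import Data.Empty using (⊥; ⊥-elim)
open import Function using (_∘_)
open import Function.Bundles using (_⇔_; mk⇔; Equivalence)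
open import Relation.Binary.PropositionalEquality
  using (_≡_; refl; sym; trans; cong; subst; isEquivalence; module ≡-Reasoning)
open import Relation.Binary.Definitions using (tri<; tri≈; tri>)
open import Relation.Nullary using (yes; no; contradiction)

pairsDown : ℕ → List ℕ
pairsDown zero    = []
pairsDown (suc m) = suc m ∷ suc m ∷ pairsDown m

multiset-suc : ∀ n → multiset (suc n) ≡ multiset n ++ suc n ∷ suc n ∷ []
multiset-suc n = begin
  concatMap twice (map suc (upTo (suc n)))        ≡⟨ cong (concatMap twice ∘ map suc) (sym (upTo-∷ʳ n)) ⟩
  concatMap twice (map suc (upTo n ++ [ n ]))     ≡⟨ cong (concatMap twice) (map-++ suc (upTo n) [ n ]) ⟩
  concatMap twice (map suc (upTo n) ++ [ suc n ]) ≡⟨ concatMap-++ twice (map suc (upTo n)) [ suc n ] ⟩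
  multiset n ++ twice (suc n) ++ []               ≡⟨ cong (multiset n ++_) (++-identityʳ (twice (suc n))) ⟩
  multiset n ++ twice (suc n)                     ∎
  where
  open ≡-Reasoning
  twice : ℕ → List ℕ
  twice k = k ∷ k ∷ []

multiset↭pairsDown : ∀ n → multiset n ↭ pairsDown n
multiset↭pairsDown zero    = ↭-refl
multiset↭pairsDown (suc n) = begin
  multiset (suc n)                 ≡⟨ multiset-suc n ⟩
  multiset n ++ suc n ∷ suc n ∷ [] ↭⟨ ++-comm (multiset n) _ ⟩
  suc n ∷ suc n ∷ multiset n       ↭⟨ prep (suc n) (prep (suc n) (multiset↭pairsDown n)) ⟩
  pairsDown (suc n)                ∎
  where open PermutationReasoning

pairsDown-< : ∀ m → All (_< suc m) (pairsDown m)
pairsDown-< zero    = []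
pairsDown-< (suc m) = ≤-refl ∷ ≤-refl ∷ All.map (λ x<m → <-trans x<m ≤-refl) (pairsDown-< m)

∈-pairsDown : ∀ {i m} → 0 < i → i ≤ m → i ∈ pairsDown m
∈-pairsDown {m = zero}  (s≤s _) ()
∈-pairsDown {i} {suc m} 0<i i≤1+m with i ≟ suc m
... | yes refl = here refl
... | no  i≢1+m with ≤∧≢⇒< i≤1+m i≢1+m
...   | s≤s i≤m = there (there (∈-pairsDown 0<i i≤m))

pairsDown-descending : ∀ m → Descending (pairsDown m)
pairsDown-descending zero          = []
pairsDown-descending (suc zero)    = ≤-refl ∷ [-]
pairsDown-descending (suc (suc m)) = ≤-refl ∷ n≤1+n (suc m) ∷ pairsDown-descending (suc m)

descending-unique : ∀ {xs ys} → Descending xs → Descending ys → xs ↭ ys → xs ≡ ys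
descending-unique xs↘ ys↘ xs↭ys = Pointwise-≡⇒≡ (↗↭↗⇒≋ ≥-totalOrder xs↘ ys↘ (↭⇒↭ₛ′ isEquivalence xs↭ys))

↭pairsDown-descending : ∀ {m ρ} → ρ ↭ pairsDown m → Descending ρ → ρ ≡ pairsDown m
↭pairsDown-descending {m} ρ↭ ρ↘ = descending-unique ρ↘ (pairsDown-descending m) ρ↭

↭pairsDown-< : ∀ {m ρ} → ρ ↭ pairsDown m → All (_< suc m) ρ
↭pairsDown-< {m} ρ↭ = All-resp-↭ (↭-sym ρ↭) (pairsDown-< m)

descending-by-pairs : ∀ {xs} → (∀ {x y} → x ∷ y ∷ [] ⊆ xs → y ≤ x) → Descending xs
descending-by-pairs {[]}         pairs = []
descending-by-pairs {x ∷ []}     pairs = [-]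
descending-by-pairs {x ∷ y ∷ xs} pairs =
  pairs (refl ∷ refl ∷ minimum xs) ∷ descending-by-pairs (pairs ∘ (x ∷ʳ_))

either-empty : ∀ {A : Set} {xs ys : List A} → (∀ {x y} → x ∈ xs → y ∈ ys → ⊥) → xs ≡ [] ⊎ ys ≡ []
either-empty {xs = []}                 _        = inj₁ refl
either-empty {xs = _ ∷ _} {[]}         _        = inj₂ refl
either-empty {xs = _ ∷ _} {_ ∷ _} disjoint = ⊥-elim (disjoint (here refl) (here refl))

AllPairs-resp-⊆ : ∀ {A : Set} {R : A → A → Set} {xs ys} → xs ⊆ ys → AllPairs R ys → AllPairs R xs
AllPairs-resp-⊆ []             []         = []
AllPairs-resp-⊆ (_ ∷ʳ xs⊆ys)   (_ ∷ Rys)  = AllPairs-resp-⊆ xs⊆ys Rys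
AllPairs-resp-⊆ (refl ∷ xs⊆ys) (Ry ∷ Rys) = All-resp-⊆ xs⊆ys Ry ∷ AllPairs-resp-⊆ xs⊆ys Rys

across-⊆ : ∀ {A : Set} {x y z : A} {P Q} → x ∈ P → y ∈ Q → x ∷ z ∷ y ∷ [] ⊆ P ++ z ∷ Q
across-⊆ x∈P y∈Q = ++⁺ (from∈ x∈P) (refl ∷ from∈ y∈Q)

p123 p132 p231 p312 : List ℕ
p123 = 1 ∷ 2 ∷ 3 ∷ []
p132 = 1 ∷ 3 ∷ 2 ∷ []
p231 = 2 ∷ 3 ∷ 1 ∷ []
p312 = 3 ∷ 1 ∷ 2 ∷ []

avoids-⊆ : ∀ {τ π σ} → τ ⊆ π → Avoids π σ → Avoids τ σ
avoids-⊆ τ⊆π avoid (υ , υ⊆τ , iso) = avoid (υ , ⊆-trans υ⊆τ τ⊆π , iso)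

<-reflected : ∀ {τ σ} (iso : OrderIso τ σ) {i j} →
  Data.List.lookup σ (cast (proj₁ iso) i) < Data.List.lookup σ (cast (proj₁ iso) j) →
  Data.List.lookup τ i < Data.List.lookup τ j
<-reflected (_ , compare) {i} {j} = Equivalence.from (proj₂ (compare i j))

occurrence₃ : ∀ {π p q r} → Contains π (p ∷ q ∷ r ∷ []) →
  ∃₂ λ x y → ∃ λ z → (x ∷ y ∷ z ∷ [] ⊆ π) × OrderIso (x ∷ y ∷ z ∷ []) (p ∷ q ∷ r ∷ [])
occurrence₃ (x ∷ y ∷ z ∷ [] , τ⊆π , iso) = x , y , z , τ⊆π , iso
occurrence₃ ([] , _ , () , _)
occurrence₃ (_ ∷ [] , _ , () , _)
occurrence₃ (_ ∷ _ ∷ [] , _ , () , _)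
occurrence₃ (_ ∷ _ ∷ _ ∷ _ ∷ _ , _ , () , _)

occurrence₄ : ∀ {π p q r s} → Contains π (p ∷ q ∷ r ∷ s ∷ []) →
  ∃₂ λ x y → ∃₂ λ z w → (x ∷ y ∷ z ∷ w ∷ [] ⊆ π) × OrderIso (x ∷ y ∷ z ∷ w ∷ []) (p ∷ q ∷ r ∷ s ∷ [])
occurrence₄ (x ∷ y ∷ z ∷ w ∷ [] , τ⊆π , iso) = x , y , z , w , τ⊆π , iso
occurrence₄ ([] , _ , () , _)
occurrence₄ (_ ∷ [] , _ , () , _)
occurrence₄ (_ ∷ _ ∷ [] , _ , () , _)
occurrence₄ (_ ∷ _ ∷ _ ∷ [] , _ , () , _)
occurrence₄ (_ ∷ _ ∷ _ ∷ _ ∷ _ ∷ _ , _ , () , _)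

data SameOrder (x y u v : ℕ) : Set where
  both< : x < y → u < v → SameOrder x y u v
  both> : y < x → v < u → SameOrder x y u v

sameOrder-flip : ∀ {x y u v} → SameOrder x y u v → SameOrder y x v u
sameOrder-flip (both< x<y u<v) = both> x<y u<v
sameOrder-flip (both> y<x v<u) = both< y<x v<u

sameOrder-⇔ : ∀ {x y u v} → SameOrder x y u v → ((x ≡ y) ⇔ (u ≡ v)) × ((x < y) ⇔ (u < v))
sameOrder-⇔ (both< x<y u<v) =
  mk⇔ (λ x≡y → contradiction x≡y (<⇒≢ x<y)) (λ u≡v → contradiction u≡v (<⇒≢ u<v)) ,
  mk⇔ (λ _ → u<v) (λ _ → x<y)
sameOrder-⇔ (both> y<x v<u) =
  mk⇔ (λ x≡y → contradiction (sym x≡y) (<⇒≢ y<x)) (λ u≡v → contradiction (sym u≡v) (<⇒≢ v<u)) ,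
  mk⇔ (λ x<y → contradiction y<x (<-asym x<y)) (λ u<v → contradiction v<u (<-asym u<v))

sameOrder-refl-⇔ : ∀ {x u} → ((x ≡ x) ⇔ (u ≡ u)) × ((x < x) ⇔ (u < u))
sameOrder-refl-⇔ =
  mk⇔ (λ _ → refl) (λ _ → refl) ,
  mk⇔ (λ x<x → contradiction x<x (<-irrefl refl)) (λ u<u → contradiction u<u (<-irrefl refl))

orderIso₃ : ∀ {x y z p q r} → SameOrder x y p q → SameOrder x z p r → SameOrder y z q r →
  OrderIso (x ∷ y ∷ z ∷ []) (p ∷ q ∷ r ∷ [])
orderIso₃ xy xz yz = refl , λ
  { zero             zero             → sameOrder-refl-⇔
  ; zero             (suc zero)       → sameOrder-⇔ xy
  ; zero             (suc (suc zero)) → sameOrder-⇔ xz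
  ; (suc zero)       zero             → sameOrder-⇔ (sameOrder-flip xy)
  ; (suc zero)       (suc zero)       → sameOrder-refl-⇔
  ; (suc zero)       (suc (suc zero)) → sameOrder-⇔ yz
  ; (suc (suc zero)) zero             → sameOrder-⇔ (sameOrder-flip xz)
  ; (suc (suc zero)) (suc zero)       → sameOrder-⇔ (sameOrder-flip yz)
  ; (suc (suc zero)) (suc (suc zero)) → sameOrder-refl-⇔
  }

contains₃ : ∀ {π x y z p q r} → x ∷ y ∷ z ∷ [] ⊆ π →
  SameOrder x y p q → SameOrder x z p r → SameOrder y z q r → Contains π (p ∷ q ∷ r ∷ [])
contains₃ τ⊆π xy xz yz = _ , τ⊆π , orderIso₃ xy xz yz

record Admissible (n : ℕ) (π : List ℕ) : Set where
  field
    bounded    : All (_≤ n) π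
    ascent-top : ∀ {x y} → x ∷ y ∷ [] ⊆ π → x < y → y ≡ n
    climb-top  : ∀ {x y} → x ∷ n ∷ y ∷ [] ⊆ π → x < n → y ≡ n
open Admissible

module _ {n π} (adm : Admissible n π) where

  no-ascent-below : ∀ {x y z} → x ∷ y ∷ [] ⊆ π → z ∈ π → x < y → y < z → ⊥
  no-ascent-below xy⊆π z∈π x<y y<z =
    <⇒≱ y<z (subst (_ ≤_) (sym (ascent-top adm xy⊆π x<y)) (All.lookup (bounded adm) z∈π))

  no-peak : ∀ {x y z} → x ∷ y ∷ z ∷ [] ⊆ π → x < y → z < y → ⊥
  no-peak {z = z} xyz⊆π x<y z<y with ascent-top adm (⊆-trans (refl ∷ refl ∷ z ∷ʳ []) xyz⊆π) x<y
  ... | refl = <-irrefl (climb-top adm xyz⊆π x<y) z<y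

  admissible-avoids-peak : ∀ {p q r} → p < q → r < q → Avoids π (p ∷ q ∷ r ∷ [])
  admissible-avoids-peak p<q r<q c with occurrence₃ c
  ... | _ , _ , _ , xyz⊆π , iso =
    no-peak xyz⊆π (<-reflected iso {zero} {suc zero} p<q) (<-reflected iso {suc (suc zero)} {suc zero} r<q)

  admissible-avoids-123 : Avoids π p123
  admissible-avoids-123 c with occurrence₃ c
  ... | _ , _ , z , xyz⊆π , iso =
    no-ascent-below (⊆-trans (refl ∷ refl ∷ z ∷ʳ []) xyz⊆π) (lookup xyz⊆π (there (there (here refl))))
      (<-reflected iso {zero} {suc zero} (s<s z<s))
      (<-reflected iso {suc zero} {suc (suc zero)} (s<s (s<s z<s)))

  admissible-avoids-312 : Avoids π p312
  admissible-avoids-312 c with occurrence₃ c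
  ... | x , _ , _ , xyz⊆π , iso =
    no-ascent-below (⊆-trans (x ∷ʳ refl ∷ refl ∷ []) xyz⊆π) (lookup xyz⊆π (here refl))
      (<-reflected iso {suc zero} {suc (suc zero)} (s<s z<s))
      (<-reflected iso {suc (suc zero)} {zero} (s<s (s<s z<s)))

  admissible-avoids-1212 : Avoids π (1 ∷ 2 ∷ 1 ∷ 2 ∷ [])
  admissible-avoids-1212 c with occurrence₄ c
  ... | _ , _ , _ , w , xyzw⊆π , iso =
    no-peak (⊆-trans (refl ∷ refl ∷ refl ∷ w ∷ʳ []) xyzw⊆π)
      (<-reflected iso {zero} {suc zero} (s<s z<s))
      (<-reflected iso {suc (suc zero)} {suc zero} (s<s z<s))

  admissible-avoids-2121 : Avoids π (2 ∷ 1 ∷ 2 ∷ 1 ∷ [])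
  admissible-avoids-2121 c with occurrence₄ c
  ... | x , _ , _ , _ , xyzw⊆π , iso =
    no-peak (⊆-trans (x ∷ʳ refl ∷ refl ∷ refl ∷ []) xyzw⊆π)
      (<-reflected iso {suc zero} {suc (suc zero)} (s<s z<s))
      (<-reflected iso {suc (suc (suc zero))} {suc (suc zero)} (s<s z<s))

admissible-∷ : ∀ {n π} → Admissible n π → Admissible n (n ∷ π)
admissible-∷ adm .bounded                     = ≤-refl ∷ bounded adm
admissible-∷ adm .ascent-top (_ ∷ʳ xy⊆π) x<y  = ascent-top adm xy⊆π x<y
admissible-∷ adm .ascent-top (refl ∷ y⊆π) n<y =
  contradiction (All.lookup (bounded adm) (lookup y⊆π (here refl))) (<⇒≱ n<y)
admissible-∷ adm .climb-top (_ ∷ʳ xny⊆π) x<n  = climb-top adm xny⊆π x<n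
admissible-∷ adm .climb-top (refl ∷ _) n<n    = contradiction n<n (<-irrefl refl)

MayFollow : ℕ → ℕ → ℕ → Set
MayFollow n x y = (y ≤ x ⊎ y ≡ n) × (x ≡ n → y ≡ n)

admissible-allPairs : ∀ {n π} → All (_≤ n) π → AllPairs (MayFollow n) π → Admissible n π
admissible-allPairs π≤n follows .bounded = π≤n
admissible-allPairs π≤n follows .ascent-top xy⊆π x<y with AllPairs-resp-⊆ xy⊆π follows
... | ((inj₁ y≤x , _) ∷ []) ∷ _ = contradiction y≤x (<⇒≱ x<y)
... | ((inj₂ y≡n , _) ∷ []) ∷ _ = y≡n
admissible-allPairs π≤n follows .climb-top xny⊆π _ with AllPairs-resp-⊆ xny⊆π follows
... | _ ∷ ((_ , top⇒y≡n) ∷ []) ∷ _ = top⇒y≡n refl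

module _ {n : ℕ} where

  mayFollow-descending : ∀ {ρ} → All (_< n) ρ → AllPairs _≥_ ρ → AllPairs (MayFollow n) ρ
  mayFollow-descending []          []         = []
  mayFollow-descending (x<n ∷ ρ<n) (x≥ρ ∷ ρ↘) =
    All.map (λ y≤x → inj₁ y≤x , λ x≡n → contradiction x≡n (<⇒≢ x<n)) x≥ρ ∷ mayFollow-descending ρ<n ρ↘

  mayFollow-tops : ∀ {x τ} → All (_≡ n) τ → All (MayFollow n x) τ
  mayFollow-tops = All.map (λ { refl → inj₂ refl , λ _ → refl })

  tops-allPairs : ∀ {τ} → All (_≡ n) τ → AllPairs (MayFollow n) τ
  tops-allPairs []        = []
  tops-allPairs (_ ∷ τ≡n) = mayFollow-tops τ≡n ∷ tops-allPairs τ≡n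

  admissible-descending++tops : ∀ {ρ τ} → All (_< n) ρ → Descending ρ → All (_≡ n) τ → Admissible n (ρ ++ τ)
  admissible-descending++tops {ρ} ρ<n ρ↘ τ≡n = admissible-allPairs
    (All.++⁺ (All.map <⇒≤ ρ<n) (All.map ≤-reflexive τ≡n))
    (AllPairs.++⁺ (mayFollow-descending ρ<n (Sorted⇒AllPairs ≥-totalOrder ρ↘)) (tops-allPairs τ≡n)
      (All.universal (λ _ → mayFollow-tops τ≡n) ρ))

admissible-pairsDown++tops : ∀ {m τ} → All (_≡ suc m) τ → Admissible (suc m) (pairsDown m ++ τ)
admissible-pairsDown++tops {m} = admissible-descending++tops (pairsDown-< m) (pairsDown-descending m)

spread : ℕ → List ℕ → List ℕ → List ℕ → List ℕ
spread x a b c = a ++ x ∷ b ++ x ∷ c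

record TwoOccurrences (x : ℕ) (π ρ : List ℕ) : Set where
  constructor twoOccurrences
  field
    before between after : List ℕ
    shape : π ≡ spread x before between after
    rest  : before ++ between ++ after ↭ ρ

second-occurrence : ∀ {x ρ} α δ → α ++ δ ↭ x ∷ ρ → TwoOccurrences x (α ++ x ∷ δ) ρ
second-occurrence {x} α δ αδ↭ with ∈-++⁻ α (∈-resp-↭ (↭-sym αδ↭) (here refl))
... | inj₁ x∈α with ∈-∃++ x∈α
...   | α₁ , α₂ , refl = twoOccurrences α₁ α₂ δ (++-assoc α₁ (x ∷ α₂) (x ∷ δ))
        (drop-mid α₁ [] (subst (_↭ x ∷ _) (++-assoc α₁ (x ∷ α₂) δ) αδ↭))
second-occurrence {x} α δ αδ↭ | inj₂ x∈δ with ∈-∃++ x∈δ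
...   | δ₁ , δ₂ , refl = twoOccurrences α δ₁ δ₂ refl
        (subst (_↭ _) (++-assoc α δ₁ δ₂)
          (drop-mid (α ++ δ₁) [] (subst (_↭ x ∷ _) (sym (++-assoc α δ₁ (x ∷ δ₂))) αδ↭)))

two-occurrences : ∀ {x ρ} π → π ↭ x ∷ x ∷ ρ → TwoOccurrences x π ρ
two-occurrences π π↭ with ∈-∃++ (∈-resp-↭ (↭-sym π↭) (here refl))
... | α , δ , refl = second-occurrence α δ (drop-mid α [] π↭)

module _ {n : ℕ} (P Q : List ℕ) (avoid132 : Avoids (P ++ n ∷ Q) p132) (avoid231 : Avoids (P ++ n ∷ Q) p231) where

  small-across-≡ : ∀ {x y} → x ∈ P → y ∈ Q → x < n → y < n → x ≡ y
  small-across-≡ {x} {y} x∈P y∈Q x<n y<n with <-cmp x y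
  ... | tri< x<y _ _ = contradiction (contains₃ (across-⊆ x∈P y∈Q)
    (both< x<n (s<s z<s)) (both< x<y (s<s z<s)) (both> y<n (s<s (s<s z<s)))) avoid132
  ... | tri≈ _ x≡y _ = x≡y
  ... | tri> _ _ y<x = contradiction (contains₃ (across-⊆ x∈P y∈Q)
    (both< x<n (s<s (s<s z<s))) (both> y<x (s<s z<s)) (both> y<n (s<s z<s))) avoid231

  small-letter-≡ : ∀ {x y w} → x ∈ P → y ∈ Q → x < n → y < n → w ∈ P ++ n ∷ Q → w < n → w ≡ x
  small-letter-≡ x∈P y∈Q x<n y<n w∈π w<n with ∈-++⁻ P w∈π
  ... | inj₁ w∈P         = trans (small-across-≡ w∈P y∈Q w<n y<n) (sym (small-across-≡ x∈P y∈Q x<n y<n))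
  ... | inj₂ (here w≡n)  = contradiction w≡n (<⇒≢ w<n)
  ... | inj₂ (there w∈Q) = sym (small-across-≡ x∈P w∈Q x<n w<n)

  no-small-across : 2 < n → 1 ∈ P ++ n ∷ Q → 2 ∈ P ++ n ∷ Q →
    ∀ {x y} → x ∈ P → y ∈ Q → x < n → y < n → ⊥
  no-small-across 2<n 1∈π 2∈π x∈P y∈Q x<n y<n
    with small-letter-≡ x∈P y∈Q x<n y<n 1∈π (<-trans (s<s z<s) 2<n)
       | small-letter-≡ x∈P y∈Q x<n y<n 2∈π 2<n
  ... | refl | ()  -- 1 ≡ x and 2 ≡ x

module TopsSeparate {m : ℕ} (2≤m : 2 ≤ m) {a b c : List ℕ} (r : a ++ b ++ c ↭ pairsDown m)
  (avoid132 : Avoids (spread (suc m) a b c) p132) (avoid231 : Avoids (spread (suc m) a b c) p231) where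

  private
    n = suc m

    small : ∀ {w} → w ∈ a ++ b ++ c → w < n
    small = All.lookup (↭pairsDown-< r)

    letter∈ : ∀ {i} → 0 < i → i ≤ m → i ∈ spread n a b c
    letter∈ 0<i i≤m =
      lookup (++⁺ ⊆-refl (n ∷ʳ ++⁺ ⊆-refl (n ∷ʳ ⊆-refl))) (∈-resp-↭ (↭-sym r) (∈-pairsDown 0<i i≤m))

    insert-⊆ : ∀ (xs ys : List ℕ) → xs ++ ys ⊆ xs ++ n ∷ ys
    insert-⊆ xs ys = ++⁺ ⊆-refl (n ∷ʳ ⊆-refl)

  first : a ≡ [] ⊎ (b ≡ [] × c ≡ [])
  first = Sum.map₂ (λ bc≡[] → ++-conicalˡ b c bc≡[] , ++-conicalʳ b c bc≡[]) (either-empty λ x∈a y∈bc →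
    no-small-across a (b ++ n ∷ c) avoid132 avoid231 (s≤s 2≤m) (letter∈ z<s (<⇒≤ 2≤m)) (letter∈ z<s 2≤m)
      x∈a (lookup (insert-⊆ b c) y∈bc) (small (∈-++⁺ˡ x∈a)) (small (∈-++⁺ʳ a y∈bc)))

  second : (a ≡ [] × b ≡ []) ⊎ c ≡ []
  second = Sum.map₁ (λ ab≡[] → ++-conicalˡ a b ab≡[] , ++-conicalʳ a b ab≡[]) (either-empty λ x∈ab y∈c →
    no-small-across (a ++ n ∷ b) c (avoids-⊆ (⊆-reflexive regroup) avoid132) (avoids-⊆ (⊆-reflexive regroup) avoid231)
      (s≤s 2≤m) (subst (1 ∈_) (sym regroup) (letter∈ z<s (<⇒≤ 2≤m))) (subst (2 ∈_) (sym regroup) (letter∈ z<s 2≤m))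
      (lookup (insert-⊆ a b) x∈ab) y∈c
      (small (lookup (⊆-reflexive (++-assoc a b c)) (∈-++⁺ˡ x∈ab))) (small (∈-++⁺ʳ a (∈-++⁺ʳ b y∈c))))
    where
    regroup : (a ++ n ∷ b) ++ n ∷ c ≡ spread n a b c
    regroup = ++-assoc a (n ∷ b) (n ∷ c)

no-123⇒descending : ∀ {n ρ} → All (_< n) ρ → Avoids (ρ ++ [ n ]) p123 → Descending ρ
no-123⇒descending ρ<n avoid = descending-by-pairs λ xy⊆ρ → ≮⇒≥ λ x<y → avoid
  (contains₃ (++⁺ xy⊆ρ (refl ∷ [])) (both< x<y (s<s z<s))
    (both< (All.lookup ρ<n (lookup xy⊆ρ (here refl))) (s<s z<s))
    (both< (All.lookup ρ<n (lookup xy⊆ρ (there (here refl)))) (s<s (s<s z<s))))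

no-312⇒descending : ∀ {n ρ} → All (_< n) ρ → Avoids (n ∷ ρ) p312 → Descending ρ
no-312⇒descending ρ<n avoid = descending-by-pairs λ xy⊆ρ → ≮⇒≥ λ x<y → avoid
  (contains₃ (refl ∷ xy⊆ρ)
    (both> (All.lookup ρ<n (lookup xy⊆ρ (here refl))) (s<s z<s))
    (both> (All.lookup ρ<n (lookup xy⊆ρ (there (here refl)))) (s<s (s<s z<s)))
    (both< x<y (s<s z<s)))

qbarWords : ℕ → List (List ℕ)
qbarWords m =
  (pairsDown m ++ suc m ∷ suc m ∷ []) ∷ (suc m ∷ pairsDown m ++ [ suc m ]) ∷ (suc m ∷ suc m ∷ pairsDown m) ∷ []

qbarWords-unique : ∀ m → Unique (qbarWords (suc m))
qbarWords-unique m = ((λ ()) ∷ (λ ()) ∷ []) ∷ ((λ ()) ∷ []) ∷ [] ∷ []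

patterns : List (List ℕ)
patterns = p123 ∷ p132 ∷ p231 ∷ p312 ∷ []

admissible⇒inQbar : ∀ {n π} → π ↭ pairsDown n → Admissible n π → InQbar n patterns π
admissible⇒inQbar {n} π↭ adm =
  (↭-trans π↭ (↭-sym (multiset↭pairsDown n)) , admissible-avoids-1212 adm , admissible-avoids-2121 adm) ,
  admissible-avoids-123 adm , admissible-avoids-peak adm (s<s z<s) (s<s (s<s z<s)) ,
  admissible-avoids-peak adm (s<s (s<s z<s)) (s<s z<s) , admissible-avoids-312 adm , tt

qbarWord⇒inQbar : ∀ {m π} → π ∈ qbarWords m → InQbar (suc m) patterns π
qbarWord⇒inQbar {m} (here refl) =
  admissible⇒inQbar (++-comm (pairsDown m) _) (admissible-pairsDown++tops (refl ∷ refl ∷ []))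
qbarWord⇒inQbar {m} (there (here refl)) =
  admissible⇒inQbar (prep (suc m) (++-comm (pairsDown m) _)) (admissible-∷ (admissible-pairsDown++tops (refl ∷ [])))
qbarWord⇒inQbar {m} (there (there (here refl))) =
  admissible⇒inQbar ↭-refl (admissible-∷ (admissible-∷
    (subst (Admissible (suc m)) (++-identityʳ (pairsDown m)) (admissible-pairsDown++tops []))))

classify : ∀ {m} → 2 ≤ m → ∀ {a b c} → a ++ b ++ c ↭ pairsDown m →
  Avoids (spread (suc m) a b c) p123 → Avoids (spread (suc m) a b c) p132 →
  Avoids (spread (suc m) a b c) p231 → Avoids (spread (suc m) a b c) p312 →
  spread (suc m) a b c ∈ qbarWords m
classify {m} 2≤m {a} {b} {c} r avoid123 avoid132 avoid231 avoid312
  with TopsSeparate.first 2≤m r avoid132 avoid231 | TopsSeparate.second 2≤m r avoid132 avoid231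
... | inj₂ (refl , refl) | _ = here (cong (_++ suc m ∷ suc m ∷ []) (↭pairsDown-descending a↭
      (no-123⇒descending (↭pairsDown-< a↭) (avoids-⊆ (++⁺ ⊆-refl (refl ∷ suc m ∷ʳ [])) avoid123))))
  where a↭ = subst (_↭ pairsDown m) (++-identityʳ a) r
... | inj₁ refl | inj₂ refl = there (here (cong (λ ρ → suc m ∷ ρ ++ [ suc m ]) (↭pairsDown-descending b↭
      (no-312⇒descending (↭pairsDown-< b↭) (avoids-⊆ (refl ∷ ++⁺ʳ [ suc m ] ⊆-refl) avoid312)))))
  where b↭ = subst (_↭ pairsDown m) (++-identityʳ b) r
... | inj₁ refl | inj₁ (_ , refl) = there (there (here (cong (λ ρ → suc m ∷ suc m ∷ ρ) (↭pairsDown-descending r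
      (no-312⇒descending (↭pairsDown-< r) (avoids-⊆ (suc m ∷ʳ ⊆-refl) avoid312))))))

inQbar⇒qbarWord : ∀ {m} → 2 ≤ m → ∀ π → InQbar (suc m) patterns π → π ∈ qbarWords m
inQbar⇒qbarWord {m} 2≤m π ((π↭ , _ , _) , avoid123 , avoid132 , avoid231 , avoid312 , _)
  with two-occurrences π (↭-trans π↭ (multiset↭pairsDown (suc m)))
... | twoOccurrences a b c refl r = classify 2≤m r avoid123 avoid132 avoid231 avoid312

theorem4p16 : (n : ℕ) → 3 ≤ n →
    qbar≡ n ((1 ∷ 2 ∷ 3 ∷ []) ∷ (1 ∷ 3 ∷ 2 ∷ []) ∷ (2 ∷ 3 ∷ 1 ∷ []) ∷ (3 ∷ 1 ∷ 2 ∷ []) ∷ []) 3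
theorem4p16 (suc m@(suc k)) (s≤s 2≤m) =
  qbarWords m , qbarWords-unique k , refl , λ π → mk⇔ qbarWord⇒inQbar (inQbar⇒qbarWord 2≤m π)
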